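{- Every connexive Heyting algebra is a semi-Heyting algebra.
   Context: A connexive Heyting algebra is an algebra $\langle A,\wedge,\vee,\rightarrow,0,1\rangle$ whose $\{\wedge,\vee,0,1\}$-reduct is a bounded distributive lattice with lattice order $\le$, satisfying, with $\neg x:=x\rightarrow0$: (C1) $(x\rightarrow y)\rightarrow((y\rightarrow z)\rightarrow(x\rightarrow z))=1$; (C2) $(x\rightarrow y)\rightarrow\neg(x\rightarrow\neg y)=1$; (C3) $x\wedge(x\rightarrow y)=x\wedge y$; (C4) $x\rightarrow y\le(z\wedge x)\rightarrow(z\wedge y)$; (C5) $x\rightarrow y\le(z\vee x)\rightarrow(z\vee y)$. A semi-Heyting algebra is an algebra $\langle A,\wedge,\vee,\rightarrow,0,1\rangle$ whose $\{\wedge,\vee,0,1\}$-reduct is a bounded distributive lattice satisfying (C3), (C6) $x\wedge(y\rightarrow z)=x\wedge((x\wedge y)\rightarrow(x\wedge z))$, and (C7) $x\rightarrow x=1$. -}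

module Defs where

open import Level using (Level; _⊔_; suc)
open import Relation.Binary.Core using (Rel)
open import Algebra.Core using (Op₂)
open import Algebra.Definitions using (Congruent₂)
open import Algebra.Lattice.Structures using (IsDistributiveLattice)

record IsBDLWithImp {a ℓ} {A : Set a} (_≈_ : Rel A ℓ)
                    (_∧_ _∨_ _⇒_ : Op₂ A) (𝟎 𝟏 : A) : Set (a ⊔ ℓ) where
  field
    isDistributiveLattice : IsDistributiveLattice _≈_ _∨_ _∧_
    ⇒-cong   : Congruent₂ _≈_ _⇒_
    𝟎-bottom : ∀ x → (𝟎 ∧ x) ≈ 𝟎
    𝟏-top    : ∀ x → (𝟏 ∧ x) ≈ x

record Algebra₅ (a ℓ : Level) : Set (suc (a ⊔ ℓ)) where
  infixr 5 _⇒_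
  infixr 7 _∧_
  infixr 6 _∨_
  infix  4 _≈_ _≤_
  field
    Carrier : Set a
    _≈_     : Rel Carrier ℓ
    _∧_     : Op₂ Carrier
    _∨_     : Op₂ Carrier
    _⇒_     : Op₂ Carrier
    𝟎       : Carrier
    𝟏       : Carrier
    isBDLWithImp : IsBDLWithImp _≈_ _∧_ _∨_ _⇒_ 𝟎 𝟏

  _≤_ : Rel Carrier ℓ
  x ≤ y = (x ∧ y) ≈ x

  ¬_ : Carrier → Carrier
  ¬ x = x ⇒ 𝟎

record IsConnexiveHeyting {a ℓ} (H : Algebra₅ a ℓ) : Set (a ⊔ ℓ) where
  open Algebra₅ H
  field
    C1 : ∀ x y z → ((x ⇒ y) ⇒ ((y ⇒ z) ⇒ (x ⇒ z))) ≈ 𝟏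
    C2 : ∀ x y → ((x ⇒ y) ⇒ (¬ (x ⇒ (¬ y)))) ≈ 𝟏
    C3 : ∀ x y → (x ∧ (x ⇒ y)) ≈ (x ∧ y)
    C4 : ∀ x y z → (x ⇒ y) ≤ ((z ∧ x) ⇒ (z ∧ y))
    C5 : ∀ x y z → (x ⇒ y) ≤ ((z ∨ x) ⇒ (z ∨ y))

record IsSemiHeyting {a ℓ} (H : Algebra₅ a ℓ) : Set (a ⊔ ℓ) where
  open Algebra₅ H
  field
    C3 : ∀ x y → (x ∧ (x ⇒ y)) ≈ (x ∧ y)
    C6 : ∀ x y z → (x ∧ (y ⇒ z)) ≈ (x ∧ ((x ∧ y) ⇒ (x ∧ z)))
    C7 : ∀ x → (x ⇒ x) ≈ 𝟏

{-# OPTIONS --safe #-}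
module Submission where

open import Level using (_⊔_)
open import Algebra.Lattice.Bundles using (Lattice)
open import Algebra.Lattice.Structures using (IsDistributiveLattice)
open import Relation.Binary.Lattice using (MeetSemilattice)
open import Defs

-- By (C3), 𝟏 ⇒ y ≈ y, so (C4) applied to 𝟏 ⇒ x gives x ≤ y ⇒ (x ∧ y), and
-- similarly x ≤ (x ∧ z) ⇒ z; the case x = 𝟏 of the former is (C7). (C1) and
-- (C3) yield transitivity (x ⇒ y) ∧ (y ⇒ z) ≤ x ⇒ z, so below x the arrow
-- (x ∧ y) ⇒ (x ∧ z) composes with y ⇒ (x ∧ y) and (x ∧ z) ⇒ z to give y ⇒ z;
-- (C4) gives the converse inequality of (C6).

module ImplicationLattice {a ℓ} (H : Algebra₅ a ℓ) where
  open Algebra₅ H hiding (_≤_)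
  open IsBDLWithImp isBDLWithImp
  open IsDistributiveLattice isDistributiveLattice

  lattice : Lattice a ℓ
  lattice = record { isLattice = isLattice }

  open import Algebra.Lattice.Properties.Lattice lattice using (∧-semilattice)
  open import Algebra.Lattice.Properties.Semilattice ∧-semilattice
    using (poset; ∧-orderTheoreticMeetSemilattice)
  open MeetSemilattice ∧-orderTheoreticMeetSemilattice
    using (_≤_; x∧y≤x; x∧y≤y; ∧-greatest; antisym; ≤-respˡ-≈; ≤-respʳ-≈)
    renaming (refl to ≤-refl; trans to ≤-trans)
  open import Relation.Binary.Lattice.Properties.MeetSemilattice
    ∧-orderTheoreticMeetSemilattice using (∧-monotonic)
  open import Relation.Binary.Reasoning.PartialOrder poset

  -- The library's natural order x ≈ x ∧ y is the symmetric form of Algebra₅._≤_.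
  ≤-fromAlgebra₅ : ∀ {x y} → Algebra₅._≤_ H x y → x ≤ y
  ≤-fromAlgebra₅ = sym

  ∧-identityʳ : ∀ x → x ∧ 𝟏 ≈ x
  ∧-identityʳ x = trans (∧-comm x 𝟏) (𝟏-top x)

  ≤-𝟏 : ∀ x → x ≤ 𝟏
  ≤-𝟏 x = sym (∧-identityʳ x)

  𝟏≤⇒≈𝟏 : ∀ {x} → 𝟏 ≤ x → x ≈ 𝟏
  𝟏≤⇒≈𝟏 {x} 𝟏≤x = antisym (≤-𝟏 x) 𝟏≤x

  ModusPonens : Set (a ⊔ ℓ)
  ModusPonens = ∀ x y → x ∧ (x ⇒ y) ≈ x ∧ y

  Syllogism : Set (a ⊔ ℓ)
  Syllogism = ∀ x y z → (x ⇒ y) ⇒ ((y ⇒ z) ⇒ (x ⇒ z)) ≈ 𝟏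

  MeetPrefixing : Set (a ⊔ ℓ)
  MeetPrefixing = ∀ x y z → x ⇒ y ≤ (z ∧ x) ⇒ (z ∧ y)

  module _ (mp : ModusPonens) where

    ∧-⇒-≤ : ∀ x y → x ∧ (x ⇒ y) ≤ y
    ∧-⇒-≤ x y = ≤-respˡ-≈ (sym (mp x y)) (x∧y≤y x y)

    ⇒≈𝟏⇒≤ : ∀ {x y} → x ⇒ y ≈ 𝟏 → x ≤ y
    ⇒≈𝟏⇒≤ {x} {y} x⇒y≈𝟏 = begin-equality
      x             ≈⟨ ∧-identityʳ x ⟨
      x ∧ 𝟏         ≈⟨ ∧-congˡ x⇒y≈𝟏 ⟨
      x ∧ (x ⇒ y)   ≈⟨ mp x y ⟩
      x ∧ y         ∎

    ≤-⇒𝟏 : ∀ x → x ≤ x ⇒ 𝟏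
    ≤-⇒𝟏 x = sym (trans (mp x 𝟏) (∧-identityʳ x))

    𝟏⇒-identity : ∀ y → 𝟏 ⇒ y ≈ y
    𝟏⇒-identity y = begin-equality
      𝟏 ⇒ y         ≈⟨ 𝟏-top (𝟏 ⇒ y) ⟨
      𝟏 ∧ (𝟏 ⇒ y)   ≈⟨ mp 𝟏 y ⟩
      𝟏 ∧ y         ≈⟨ 𝟏-top y ⟩
      y             ∎

    ⇒-compose : Syllogism → ∀ x y z → (x ⇒ y) ∧ (y ⇒ z) ≤ x ⇒ z
    ⇒-compose syll x y z = begin
      (x ⇒ y) ∧ (y ⇒ z)              ≤⟨ ∧-monotonic (⇒≈𝟏⇒≤ (syll x y z)) ≤-refl ⟩
      ((y ⇒ z) ⇒ (x ⇒ z)) ∧ (y ⇒ z)  ≈⟨ ∧-comm _ _ ⟩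
      (y ⇒ z) ∧ ((y ⇒ z) ⇒ (x ⇒ z))  ≤⟨ ∧-⇒-≤ (y ⇒ z) (x ⇒ z) ⟩
      x ⇒ z                          ∎

    module _ (prefix : MeetPrefixing) where

      ≤-⇒-∧ : ∀ x y → x ≤ y ⇒ (x ∧ y)
      ≤-⇒-∧ x y = begin
        x                 ≈⟨ 𝟏⇒-identity x ⟨
        𝟏 ⇒ x             ≤⟨ prefix 𝟏 x y ⟩
        (y ∧ 𝟏) ⇒ (y ∧ x) ≈⟨ ⇒-cong (∧-identityʳ y) (∧-comm y x) ⟩
        y ⇒ (x ∧ y)       ∎

      ≤-∧-⇒ : ∀ x z → x ≤ (x ∧ z) ⇒ z
      ≤-∧-⇒ x z = begin
        x                 ≤⟨ ≤-⇒𝟏 x ⟩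
        x ⇒ 𝟏             ≤⟨ prefix x 𝟏 z ⟩
        (z ∧ x) ⇒ (z ∧ 𝟏) ≈⟨ ⇒-cong (∧-comm z x) (∧-identityʳ z) ⟩
        (x ∧ z) ⇒ z       ∎

      ⇒-refl : ∀ x → x ⇒ x ≈ 𝟏
      ⇒-refl x = 𝟏≤⇒≈𝟏 (≤-respʳ-≈ (⇒-cong refl (𝟏-top x)) (≤-⇒-∧ 𝟏 x))

      ⇒-relativise : Syllogism →
                     ∀ x y z → x ∧ (y ⇒ z) ≈ x ∧ ((x ∧ y) ⇒ (x ∧ z))
      ⇒-relativise syll x y z = antisym
        (∧-greatest (x∧y≤x x _) (≤-trans (x∧y≤y x _) (prefix y z x)))
        (∧-greatest (x∧y≤x x _) restrict)
        where
        restrict : x ∧ ((x ∧ y) ⇒ (x ∧ z)) ≤ y ⇒ z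
        restrict = begin
          x ∧ ((x ∧ y) ⇒ (x ∧ z))
            ≤⟨ ∧-greatest (∧-monotonic (≤-⇒-∧ x y) ≤-refl)
                          (≤-trans (x∧y≤x x _) (≤-∧-⇒ x z)) ⟩
          ((y ⇒ (x ∧ y)) ∧ ((x ∧ y) ⇒ (x ∧ z))) ∧ ((x ∧ z) ⇒ z)
            ≤⟨ ∧-monotonic (⇒-compose syll y (x ∧ y) (x ∧ z)) ≤-refl ⟩
          (y ⇒ (x ∧ z)) ∧ ((x ∧ z) ⇒ z)
            ≤⟨ ⇒-compose syll y (x ∧ z) z ⟩
          y ⇒ z ∎

lemma3p4 : ∀ {a ℓ} (H : Algebra₅ a ℓ) → IsConnexiveHeyting H → IsSemiHeyting H
lemma3p4 H CH = record
  { C3 = C3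
  ; C6 = ⇒-relativise C3 prefix C1
  ; C7 = ⇒-refl C3 prefix
  }
  where
  open IsConnexiveHeyting CH
  open ImplicationLattice H
  prefix : MeetPrefixing
  prefix x y z = ≤-fromAlgebra₅ (C4 x y z)
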